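{- Let $n\ge2$, $k\ge3$, $\varepsilon>0$ and let $f:S_k^n\to[k]$ be a social choice function with $\mathbf{D}(f,\overline{\mathrm{NONMANIP}})\ge\varepsilon$, and let $a\neq b$ be alternatives. If, for uniform $\sigma\in S_k^n$, $\mathbb{P}(\sigma\in\mathrm{Sm}(B_1^{a,b}))\ge\frac{\varepsilon}{nk^3}$, then $$\mathbb{P}\Big(\sigma\in\bigcup_{z\in\{ -1,1\}^n}\partial\big(B_1^{a,b}(z)\big)\Big)\ge\frac{\varepsilon^4}{2n^5k^{12}\,k!}.$$
   Context: $S_k$ is the set of total orderings of $[k]$; a social choice function is $f:S_k^n\to[k]$. $\overline{\mathrm{NONMANIP}}$ is the set of SCFs depending on only one coordinate or taking at most two values; $\mathbf{D}(f,G)=\min_{g\in G}\mathbb{P}(f(\sigma)\ne g(\sigma))$. $B_1^{a,b}$ is the set of pairs $(\sigma,\sigma')$ differing exactly in coordinate $1$ with $f(\sigma)=a$, $f(\sigma')=b$. $x^{a,b}(\sigma)\in\{ -1,1\}^n$ has $x^{a,b}_j(\sigma)=1$ iff $\sigma_j$ ranks $a$ above $b$. $F^{a,b}(z)=\{\sigma:x^{a,b}(\sigma)=z\}$, $B_1^{a,b}(z)=\{\sigma\in F^{a,b}(z): f(\sigma)=a,\ \exists\sigma'\text{ with }(\sigma,\sigma')\in B_1^{a,b}\}$. $B_1^{a,b}(z)$ is small if $\mathbb{P}(\sigma\in B_1^{a,b}(z)\mid\sigma\in F^{a,b}(z))<1-\frac{\varepsilon^3}{4n^3k^9}$; $\mathrm{Sm}(B_1^{a,b})$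 is the union of all small fibers. $\partial(B_1^{a,b}(z))$ is the set of $\sigma\in B_1^{a,b}(z)$ having some $\pi\in F^{a,b}(z)\setminus B_1^{a,b}(z)$ that differs from $\sigma$ in exactly one coordinate.
   Formalization: The parameter ε, which also fixes the threshold for small fibers of $B_1^{a,b}$, is a positive rational. -}

module Defs where

open import Data.Bool using (Bool; true; false; _∧_; _∨_; not; if_then_else_)
open import Data.Nat as ℕ using (ℕ; zero; suc; _<ᵇ_; _≡ᵇ_)
open import Data.Fin as Fin using (Fin; toℕ)
open import Data.Fin.Properties using () renaming (_≟_ to _≟ᶠ_)
open import Data.Bool using () renaming (_≟_ to _≟ᵇ_)
open import Data.Vec as Vec using (Vec; []; _∷_; lookup; toList)
open import Data.Vec.Properties using (≡-dec)
open import Data.List as List using (List; []; _∷_; length; filter; concatMap; map)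
open import Data.Bool.ListAction using (any; all)
open import Data.List.Relation.Unary.All using (All)
open import Data.Integer using (+_)
open import Data.Rational using (ℚ; 0ℚ; _/_; _<_; _≤_)
open import Data.Rational.Properties using (_<?_)
open import Relation.Nullary using (does)
open import Relation.Binary.PropositionalEquality using (_≡_)
open import Data.Product using (∃; _×_)
open import Data.Sum using (_⊎_)

vecsOver : ∀ {A : Set} → List A → (m : ℕ) → List (Vec A m)
vecsOver xs zero    = [] ∷ []
vecsOver xs (suc m) = concatMap (λ x → map (x ∷_) (vecsOver xs m)) xs

count : ∀ {A : Set} → (A → Bool) → List A → ℕ
count p xs = length (filter (λ x → p x ≟ᵇ true) xs)

-- a / d as a rational (d = 0 never occurs in our uses; it is then sent to 0)
frac : ℕ → ℕ → ℚ
frac a zero    = 0ℚ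
frac a (suc d) = (+ a) / suc d

_==ᶠ_ : ∀ {k} → Fin k → Fin k → Bool
x ==ᶠ y = does (x ≟ᶠ y)

_==ᵇ_ : Bool → Bool → Bool
x ==ᵇ y = does (x ≟ᵇ y)

-- Rankings: a total order of [k] = Fin k, written as the list of the
-- alternatives from top to bottom (a vector of length k with no repeats).

Ranking : ℕ → Set
Ranking k = Vec (Fin k) k

_==ʳ_ : ∀ {k} → Ranking k → Ranking k → Bool
r ==ʳ s = does (≡-dec _≟ᶠ_ r s)

noDup : ∀ {k} → List (Fin k) → Bool
noDup []       = true
noDup (x ∷ xs) = not (any (x ==ᶠ_) xs) ∧ noDup xs

validRanking : ∀ {k} → Ranking k → Bool
validRanking r = noDup (toList r)

Sk : (k : ℕ) → List (Ranking k)
Sk k = filter (λ r → validRanking r ≟ᵇ true) (vecsOver (List.allFin k) k)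

-- profiles (elements of S_k^n are exactly the valid ones)
Profile : ℕ → ℕ → Set
Profile n k = Vec (Ranking k) n

Skn : (n k : ℕ) → List (Profile n k)
Skn n k = vecsOver (Sk k) n

IsProfile : ∀ {n k} → Profile n k → Set
IsProfile σ = All (λ r → validRanking r ≡ true) (toList σ)

-- A social choice function; only its values on valid profiles matter.
SCF : ℕ → ℕ → Set
SCF n k = Profile n k → Fin k

Prob : ∀ {n k} → (Profile n k → Bool) → ℚ
Prob {n} {k} p = frac (count p (Skn n k)) (length (Skn n k))

DependsOnOneCoord : ∀ {n k} → SCF n k → Set
DependsOnOneCoord {n} {k} g =
  ∃ λ (i : Fin n) → ∀ (σ τ : Profile n k) → IsProfile σ → IsProfile τ →
    lookup σ i ≡ lookup τ i → g σ ≡ g τ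

AtMostTwoValues : ∀ {n k} → SCF n k → Set
AtMostTwoValues {n} {k} g =
  ∃ λ (a : Fin k) → ∃ λ (b : Fin k) → ∀ (σ : Profile n k) → IsProfile σ →
    (g σ ≡ a) ⊎ (g σ ≡ b)

NonManipBar : ∀ {n k} → SCF n k → Set
NonManipBar g = DependsOnOneCoord g ⊎ AtMostTwoValues g

disagree : ∀ {n k} → SCF n k → SCF n k → ℚ
disagree f g = Prob (λ σ → not (f σ ==ᶠ g σ))

-- D(f, NONMANIP-bar) ≥ ε  (the min over the finite class is ≥ ε
-- iff every member is at distance ≥ ε)
DistNonManipAtLeast : ∀ {n k} → SCF n k → ℚ → Set
DistNonManipAtLeast f ε = ∀ g → NonManipBar g → ε ≤ disagree f g

-- position of alternative a in ranking r (top = 0)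
pos : ∀ {k m} → Vec (Fin k) m → Fin k → ℕ
pos []       a = 0
pos (x ∷ xs) a = if x ==ᶠ a then 0 else suc (pos xs a)

ranksAbove : ∀ {k} → Ranking k → Fin k → Fin k → Bool
ranksAbove r a b = pos r a <ᵇ pos r b

-- x^{a,b}(σ) ∈ {-1,1}^n, with true for 1 and false for -1
xab : ∀ {n k} → Fin k → Fin k → Profile n k → Vec Bool n
xab a b σ = Vec.map (λ r → ranksAbove r a b) σ

_==ᵛ_ : ∀ {n} → Vec Bool n → Vec Bool n → Bool
z ==ᵛ w = does (≡-dec _≟ᵇ_ z w)

cube : (n : ℕ) → List (Vec Bool n)
cube n = vecsOver (true ∷ false ∷ []) n

inF : ∀ {n k} → Fin k → Fin k → Vec Bool n → Profile n k → Bool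
inF a b z σ = xab a b σ ==ᵛ z

-- σ and σ' differ exactly in coordinate 1 (index 0)
differExactlyIn1 : ∀ {n k} → Profile n k → Profile n k → Bool
differExactlyIn1 {n} σ σ' =
  all (λ j → (toℕ j ≡ᵇ 0) ==ᵇ not (lookup σ j ==ʳ lookup σ' j)) (List.allFin n)

differInExactlyOne : ∀ {n k} → Profile n k → Profile n k → Bool
differInExactlyOne {n} σ π =
  count (λ j → not (lookup σ j ==ʳ lookup π j)) (List.allFin n) ≡ᵇ 1

inB1 : ∀ {n k} → SCF n k → Fin k → Fin k → Vec Bool n → Profile n k → Bool
inB1 {n} {k} f a b z σ =
  inF a b z σ ∧ (f σ ==ᶠ a) ∧
  any (λ σ' → differExactlyIn1 σ σ' ∧ (f σ' ==ᶠ b)) (Skn n k)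

isSmall : ∀ {n k} → ℚ → SCF n k → Fin k → Fin k → Vec Bool n → Bool
isSmall {n} {k} ε f a b z =
  does (frac (count (inB1 f a b z) (Skn n k)) (count (inF a b z) (Skn n k))
        <? (1ℚ - ε * ε * ε * frac 1 (4 ℕ.* n ℕ.^ 3 ℕ.* k ℕ.^ 9)))
  where open Data.Rational using (1ℚ; _-_; _*_)

inSm : ∀ {n k} → ℚ → SCF n k → Fin k → Fin k → Profile n k → Bool
inSm {n} ε f a b σ = any (λ z → isSmall ε f a b z ∧ inB1 f a b z σ) (cube n)

inBoundary : ∀ {n k} → SCF n k → Fin k → Fin k → Vec Bool n → Profile n k → Bool
inBoundary {n} {k} f a b z σ =
  inB1 f a b z σ ∧
  any (λ π → inF a b z π ∧ not (inB1 f a b z π) ∧ differInExactlyOne σ π) (Skn n k)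

inUnionBoundary : ∀ {n k} → SCF n k → Fin k → Fin k → Profile n k → Bool
inUnionBoundary {n} f a b σ = any (λ z → inBoundary f a b z σ) (cube n)

module Submission where

-- Fix alternatives a, b and a sign vector z.  The fiber F = F^{a,b}(z) is a
-- product set: it is closed under "hybrids", which take the first j coordinates from one
-- profile and the rest from another.  Given x ∈ B = B_1^{a,b}(z) and y ∈ F \ B, walking
-- from x to y one coordinate at a time must leave B at some first step j; the profile just
-- before that step lies on the boundary ∂B.  The pair (x , y) is recovered from the two
-- complementary hybrids at step j, which gives an injection
--     B × (F \ B)  ↪  ∂B × [n] × F,   i.e.   |B| |F \ B| ≤ n |∂B| |F|.
-- On a small fiber |F \ B| ≥ δ |F| (δ = ε³/(4n³k⁹)), hence δ |B| ≤ n |∂B|.  The events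
-- "σ ∈ Sm(B_1^{a,b})" and "σ ∈ ⋃ ∂B_1^{a,b}(z)" are disjoint unions over z (each σ lies in
-- the single fiber z = x^{a,b}(σ)), so summing gives δ P(Sm) ≤ n P(∂), and the stated
-- bound follows from P(Sm) ≥ ε/(nk³) and 4n⁵k¹² ≤ 2n⁵k¹²k!.

open import Defs
open import Data.Bool using (Bool; true; false; _∧_; not; if_then_else_)
open import Data.Bool.Properties using (T-≡; ∧-conicalˡ; ∧-conicalʳ; not-injective) renaming (_≟_ to _≟ᵇ_)
open import Data.Bool.ListAction using (any)
open import Data.Empty using (⊥-elim)
open import Data.Fin as Fin using (Fin; toℕ)
open import Data.Fin.Properties using (toℕ<n; toℕ-injective) renaming (_≟_ to _≟ᶠ_)
import Data.Integer as ℤ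
open import Data.Integer.Base using () renaming (+_ to ℤ⁺)
import Data.Integer.Properties as ℤP
open import Data.Rational as ℚ using (ℚ; 0ℚ; 1ℚ; _-_; toℚᵘ)
  renaming (_≤_ to _≤ℚ_; _<_ to _<ℚ_; _*_ to _*ℚ_; _+_ to _+ℚ_)
import Data.Rational.Properties as ℚP
open import Data.Rational.Unnormalised as ℚᵘ using (mkℚᵘ; *≡*) renaming (_≃_ to _≃ᵘ_)
import Data.Rational.Unnormalised.Properties as ℚᵘP
open import Data.List as List using (List; []; _∷_; length; filter; map; cartesianProduct; upTo; allFin)
open import Data.List.Membership.Propositional using (_∈_)
open import Data.List.Membership.Propositional.Properties using (∈-map⁺; ∈-map⁻; ∈-concatMap⁺; ∈-concatMap⁻; ∈-filter⁺; ∈-filter⁻; ∈-cartesianProduct⁺; ∈-cartesianProduct⁻; ∈-upTo⁺)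
open import Data.List.Properties using (length-map; length-++; length-upTo)
open import Data.List.Relation.Binary.Disjoint.Propositional using (Disjoint)
open import Data.List.Relation.Unary.All as All using (All; []; _∷_)
import Data.List.Relation.Unary.All.Properties as Allₚ
open import Data.List.Relation.Unary.AllPairs using (AllPairs; []; _∷_)
import Data.List.Relation.Unary.AllPairs.Properties as AllPairsₚ
open import Data.List.Relation.Unary.Any as Any using (here; there)
open import Data.List.Relation.Unary.Unique.Propositional using (Unique)
import Data.List.Relation.Unary.Unique.Propositional.Properties as Uniqueₚ
open import Data.Nat using (ℕ; NonZero; >-nonZero; zero; suc; _+_; _*_; _^_; _!; _≤_; _<_; z≤n; s≤s; _<ᵇ_; _≡ᵇ_)
open import Data.Nat.Properties
open import Data.Nat.Solver using (module +-*-Solver)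
open import Algebra.Properties.CommutativeSemigroup +-commutativeSemigroup using (interchange)
open import Data.Product using (_×_; _,_; proj₁; proj₂)
import Data.Product.Properties as Productₚ
open import Data.Sum using (_⊎_; inj₁; inj₂)
open import Function.Bundles using (Equivalence)
open import Data.Vec using (Vec; []; _∷_; lookup; tabulate)
open import Data.Vec.Properties using (≡-dec; lookup-map; lookup∘tabulate; tabulate∘lookup; tabulate-cong; ∷-injectiveˡ; ∷-injectiveʳ)
open import Relation.Binary.Definitions using (DecidableEquality; tri<; tri≈; tri>)
open import Level using (0ℓ)
open import Relation.Binary.PropositionalEquality
open import Relation.Nullary using (Dec; yes; no; does)
open import Relation.Nullary.Decidable using (dec-true; dec-false; dec⇒maybe)
open import Tactic.RingSolver using () renaming (solve-∀ to ring-∀)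
open import Tactic.RingSolver.Core.AlmostCommutativeRing using (AlmostCommutativeRing; fromCommutativeRing)

𝟙 : Bool → ℕ
𝟙 true  = 1
𝟙 false = 0

∑ : {A : Set} → (A → ℕ) → List A → ℕ
∑ f []       = 0
∑ f (x ∷ xs) = f x + ∑ f xs

module _ {A : Set} where

  ∑-cong : (f g : A → ℕ) (xs : List A) → (∀ x → x ∈ xs → f x ≡ g x) → ∑ f xs ≡ ∑ g xs
  ∑-cong f g []       _  = refl
  ∑-cong f g (x ∷ xs) eq = cong₂ _+_ (eq x (here refl)) (∑-cong f g xs (λ y y∈ → eq y (there y∈)))

  ∑-+ : (f g : A → ℕ) (xs : List A) → ∑ (λ x → f x + g x) xs ≡ ∑ f xs + ∑ g xs
  ∑-+ f g []       = refl
  ∑-+ f g (x ∷ xs) = begin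
    f x + g x + ∑ (λ x → f x + g x) xs  ≡⟨ cong ((f x + g x) +_) (∑-+ f g xs) ⟩
    f x + g x + (∑ f xs + ∑ g xs)       ≡⟨ interchange (f x) (g x) (∑ f xs) (∑ g xs) ⟩
    f x + ∑ f xs + (g x + ∑ g xs)       ∎
    where open ≡-Reasoning

  ∑-zero : (f : A → ℕ) (xs : List A) → (∀ x → x ∈ xs → f x ≡ 0) → ∑ f xs ≡ 0
  ∑-zero f xs vanish = trans (∑-cong f (λ _ → 0) xs vanish) (∑-const0 xs)
    where
    ∑-const0 : (xs : List A) → ∑ (λ _ → 0) xs ≡ 0
    ∑-const0 []       = refl
    ∑-const0 (_ ∷ xs) = ∑-const0 xs

∑-swap : {A B : Set} (f : A → B → ℕ) (xs : List A) (ys : List B) →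
         ∑ (λ x → ∑ (f x) ys) xs ≡ ∑ (λ y → ∑ (λ x → f x y) xs) ys
∑-swap f []       ys = sym (∑-zero (λ _ → 0) ys (λ _ _ → refl))
∑-swap f (x ∷ xs) ys = trans (cong (∑ (f x) ys +_) (∑-swap f xs ys))
                             (sym (∑-+ (f x) (λ y → ∑ (λ x′ → f x′ y) xs) ys))

true≢false : true ≢ false
true≢false ()

from-does : {P : Set} (d : Dec P) → does d ≡ true → P
from-does (yes p) _  = p
from-does (no _)  ()

∧-intro : ∀ {b c} → b ≡ true → c ≡ true → (b ∧ c) ≡ true
∧-intro refl refl = refl

module _ {A : Set} where

  count-∷ : (p : A → Bool) (x : A) (xs : List A) → count p (x ∷ xs) ≡ 𝟙 (p x) + count p xs
  count-∷ p x xs with p x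
  ... | true  = refl
  ... | false = refl

  count≡∑ : (p : A → Bool) (xs : List A) → count p xs ≡ ∑ (λ x → 𝟙 (p x)) xs
  count≡∑ p []       = refl
  count≡∑ p (x ∷ xs) = trans (count-∷ p x xs) (cong (𝟙 (p x) +_) (count≡∑ p xs))

  count-cong : (p q : A → Bool) (xs : List A) → (∀ x → x ∈ xs → p x ≡ q x) → count p xs ≡ count q xs
  count-cong p q xs p≡q = begin
    count p xs               ≡⟨ count≡∑ p xs ⟩
    ∑ (λ x → 𝟙 (p x)) xs     ≡⟨ ∑-cong _ _ xs (λ x x∈ → cong 𝟙 (p≡q x x∈)) ⟩
    ∑ (λ x → 𝟙 (q x)) xs     ≡⟨ count≡∑ q xs ⟨
    count q xs               ∎
    where open ≡-Reasoning

  count-false : (xs : List A) → count (λ _ → false) xs ≡ 0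
  count-false []       = refl
  count-false (_ ∷ xs) = count-false xs

  count-split : (p q : A → Bool) (xs : List A) →
                count p xs ≡ count (λ x → p x ∧ q x) xs + count (λ x → p x ∧ not (q x)) xs
  count-split p q xs = begin
    count p xs                                                      ≡⟨ count≡∑ p xs ⟩
    ∑ (λ x → 𝟙 (p x)) xs                                            ≡⟨ ∑-cong _ _ xs (λ x _ → 𝟙-split (p x) (q x)) ⟩
    ∑ (λ x → 𝟙 (p x ∧ q x) + 𝟙 (p x ∧ not (q x))) xs               ≡⟨ ∑-+ _ _ xs ⟩
    ∑ (λ x → 𝟙 (p x ∧ q x)) xs + ∑ (λ x → 𝟙 (p x ∧ not (q x))) xs  ≡⟨ cong₂ _+_ (count≡∑ _ xs) (count≡∑ _ xs) ⟨
    count (λ x → p x ∧ q x) xs + count (λ x → p x ∧ not (q x)) xs   ∎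
    where
    open ≡-Reasoning
    𝟙-split : ∀ b c → 𝟙 b ≡ 𝟙 (b ∧ c) + 𝟙 (b ∧ not c)
    𝟙-split true  true  = refl
    𝟙-split true  false = refl
    𝟙-split false _     = refl

  any-witness : (p : A → Bool) {x : A} (xs : List A) → x ∈ xs → p x ≡ true → any p xs ≡ true
  any-witness p (y ∷ xs) (here refl) px rewrite px = refl
  any-witness p (y ∷ xs) (there x∈) px with p y
  ... | true  = refl
  ... | false = any-witness p xs x∈ px

𝟙-any : {Z : Set} (Q : Z → Bool) (w : Z) (zs : List Z) → Unique zs →
        (∀ z → Q z ≡ true → z ≡ w) → 𝟙 (any Q zs) ≡ ∑ (λ z → 𝟙 (Q z)) zs
𝟙-any Q w []       _              _   = refl
𝟙-any Q w (x ∷ xs) (x∉xs ∷ uniq) Q⇒w with Q x in Qx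
... | false = 𝟙-any Q w xs uniq Q⇒w
... | true  = cong suc (sym (∑-zero _ xs othersFail))
  where
  othersFail : ∀ y → y ∈ xs → 𝟙 (Q y) ≡ 0
  othersFail y y∈ with Q y in Qy
  ... | false = refl
  ... | true  = ⊥-elim (All.lookup x∉xs y∈ (trans (Q⇒w x Qx) (sym (Q⇒w y Qy))))

count-any : {A Z : Set} (P : Z → A → Bool) (key : A → Z) (zs : List Z) → Unique zs →
            (∀ z σ → P z σ ≡ true → z ≡ key σ) → (L : List A) →
            count (λ σ → any (λ z → P z σ) zs) L ≡ ∑ (λ z → count (P z) L) zs
count-any P key zs uniq P⇒key L = begin
  count (λ σ → any (λ z → P z σ) zs) L  ≡⟨ count≡∑ _ L ⟩
  ∑ (λ σ → 𝟙 (any (λ z → P z σ) zs)) L  ≡⟨ ∑-cong _ _ L (λ σ _ → 𝟙-any _ (key σ) zs uniq (λ z → P⇒key z σ)) ⟩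
  ∑ (λ σ → ∑ (λ z → 𝟙 (P z σ)) zs) L    ≡⟨ ∑-swap (λ σ z → 𝟙 (P z σ)) L zs ⟩
  ∑ (λ z → ∑ (λ σ → 𝟙 (P z σ)) L) zs    ≡⟨ ∑-cong _ _ zs (λ z _ → count≡∑ (P z) L) ⟨
  ∑ (λ z → count (P z) L) zs            ∎
  where open ≡-Reasoning

-- A duplicate-free list contained in ys is no longer than ys (the counting form of
-- injectivity used for the isoperimetric bound).
module _ {A : Set} (_≟_ : DecidableEquality A) where

  delete : A → List A → List A
  delete x []       = []
  delete x (y ∷ ys) with x ≟ y
  ... | yes _ = ys
  ... | no  _ = y ∷ delete x ys

  length-delete : ∀ x ys → x ∈ ys → length ys ≡ suc (length (delete x ys))
  length-delete x (y ∷ ys) x∈ with x ≟ y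
  length-delete x (y ∷ ys) x∈          | yes _   = refl
  length-delete x (y ∷ ys) (here refl) | no  x≢y = ⊥-elim (x≢y refl)
  length-delete x (y ∷ ys) (there x∈)  | no  _   = cong suc (length-delete x ys x∈)

  ∈-delete : ∀ x ys {z} → z ∈ ys → z ≢ x → z ∈ delete x ys
  ∈-delete x (y ∷ ys) z∈ z≢x with x ≟ y
  ∈-delete x (y ∷ ys) (here refl) z≢x | yes refl = ⊥-elim (z≢x refl)
  ∈-delete x (y ∷ ys) (there z∈)  z≢x | yes refl = z∈
  ∈-delete x (y ∷ ys) (here refl) z≢x | no  _    = here refl
  ∈-delete x (y ∷ ys) (there z∈)  z≢x | no  _    = there (∈-delete x ys z∈ z≢x)

  unique-length-≤ : ∀ xs ys → Unique xs → (∀ {z} → z ∈ xs → z ∈ ys) → length xs ≤ length ys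
  unique-length-≤ []       ys _              _    = z≤n
  unique-length-≤ (x ∷ xs) ys (x∉xs ∷ uniq) xs⊆ys =
    subst (suc (length xs) ≤_) (sym (length-delete x ys (xs⊆ys (here refl))))
      (s≤s (unique-length-≤ xs (delete x ys) uniq
        (λ z∈ → ∈-delete x ys (xs⊆ys (there z∈)) (λ { refl → All.lookup x∉xs z∈ refl }))))

module _ {A : Set} (xs : List A) where

  vecsOver-complete : (m : ℕ) (v : Vec A m) → (∀ i → lookup v i ∈ xs) → v ∈ vecsOver xs m
  vecsOver-complete zero    []      _      = here refl
  vecsOver-complete (suc m) (x ∷ v) inside =
    ∈-concatMap⁺ (λ y → map (y ∷_) (vecsOver xs m))
      (Any.map (λ { refl → ∈-map⁺ (x ∷_) (vecsOver-complete m v (λ i → inside (Fin.suc i))) })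
               (inside Fin.zero))

  vecsOver-sound : (m : ℕ) (v : Vec A m) → v ∈ vecsOver xs m → ∀ i → lookup v i ∈ xs
  vecsOver-sound (suc m) (x ∷ v) v∈ = entry
    where
    headBlock : Any.Any (λ y → (x ∷ v) ∈ map (y ∷_) (vecsOver xs m)) xs
    headBlock = ∈-concatMap⁻ (λ y → map (y ∷_) (vecsOver xs m)) v∈
    headIs : ∀ {y} → (x ∷ v) ∈ map (y ∷_) (vecsOver xs m) → x ≡ y
    headIs p with _ , _ , eq ← ∈-map⁻ _ p = ∷-injectiveˡ eq
    tailIn : ∀ {y} → (x ∷ v) ∈ map (y ∷_) (vecsOver xs m) → v ∈ vecsOver xs m
    tailIn p with w , w∈ , eq ← ∈-map⁻ _ p = subst (_∈ vecsOver xs m) (sym (∷-injectiveʳ eq)) w∈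
    entry : ∀ i → lookup (x ∷ v) i ∈ xs
    entry Fin.zero    = Any.map headIs headBlock
    entry (Fin.suc i) = vecsOver-sound m v (tailIn (proj₂ (Any.satisfied headBlock))) i

  vecsOver-unique : Unique xs → (m : ℕ) → Unique (vecsOver xs m)
  vecsOver-unique uniq zero    = [] ∷ []
  vecsOver-unique uniq (suc m) =
    Uniqueₚ.concat⁺ (Allₚ.map⁺ (blocksUnique xs))
                    (AllPairsₚ.map⁺ (mapAllPairs blocksDisjoint uniq))
    where
    V = vecsOver xs m
    blocksUnique : ∀ ys → All (λ y → Unique (map (y ∷_) V)) ys
    blocksUnique []       = []
    blocksUnique (y ∷ ys) = Uniqueₚ.map⁺ ∷-injectiveʳ (vecsOver-unique uniq m) ∷ blocksUnique ys
    blocksDisjoint : ∀ {y z} → y ≢ z → Disjoint (map (y ∷_) V) (map (z ∷_) V)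
    blocksDisjoint y≢z (p , q) with _ , _ , e₁ ← ∈-map⁻ _ p | _ , _ , e₂ ← ∈-map⁻ _ q =
      y≢z (∷-injectiveˡ (trans (sym e₁) e₂))
    mapAllPairs : ∀ {R S : A → A → Set} → (∀ {y z} → R y z → S y z) →
                  ∀ {ys} → AllPairs R ys → AllPairs S ys
    mapAllPairs f []       = []
    mapAllPairs f (r ∷ rs) = All.map f r ∷ mapAllPairs f rs

Skn-unique : (n k : ℕ) → Unique (Skn n k)
Skn-unique n k = vecsOver-unique (Sk k)
  (Uniqueₚ.filter⁺ _ (vecsOver-unique (allFin k) (Uniqueₚ.allFin⁺ k) k)) n

cube-unique : (n : ℕ) → Unique (cube n)
cube-unique = vecsOver-unique (true ∷ false ∷ []) (((λ ()) ∷ []) ∷ [] ∷ [])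

<ᵇ-true : ∀ {m n} → m < n → (m <ᵇ n) ≡ true
<ᵇ-true m<n = Equivalence.to T-≡ (<⇒<ᵇ m<n)

<ᵇ-false : ∀ {m n} → n ≤ m → (m <ᵇ n) ≡ false
<ᵇ-false {m}     {zero}  _         = refl
<ᵇ-false {suc m} {suc n} (s≤s n≤m) = <ᵇ-false n≤m

-- Going from hybrid j to hybrid (suc j) changes only coordinate j, and the pair
-- (x , y) is recovered from the two complementary hybrids at the same j.
module _ {A : Set} {n : ℕ} where

  hybrid : ℕ → Vec A n → Vec A n → Vec A n
  hybrid j x y = tabulate (λ t → if toℕ t <ᵇ j then lookup y t else lookup x t)

  lookup-hybrid : ∀ j x y t → lookup (hybrid j x y) t ≡ (if toℕ t <ᵇ j then lookup y t else lookup x t)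
  lookup-hybrid j x y t = lookup∘tabulate _ t

  vec-ext : (u v : Vec A n) → (∀ t → lookup u t ≡ lookup v t) → u ≡ v
  vec-ext u v eq = trans (sym (tabulate∘lookup u)) (trans (tabulate-cong eq) (tabulate∘lookup v))

  hybrid-zero : ∀ x y → hybrid 0 x y ≡ x
  hybrid-zero x y = tabulate∘lookup x

  hybrid-full : ∀ x y → hybrid n x y ≡ y
  hybrid-full x y =
    trans (tabulate-cong (λ t → cong (if_then lookup y t else lookup x t) (<ᵇ-true (toℕ<n t))))
          (tabulate∘lookup y)

  hybrid-recover : ∀ j x y → hybrid j (hybrid j x y) (hybrid j y x) ≡ x
  hybrid-recover j x y = vec-ext _ _ coordinate
    where
    coordinate : ∀ t → lookup (hybrid j (hybrid j x y) (hybrid j y x)) t ≡ lookup x t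
    coordinate t rewrite lookup-hybrid j (hybrid j x y) (hybrid j y x) t
                       | lookup-hybrid j x y t | lookup-hybrid j y x t with toℕ t <ᵇ j
    ... | true  = refl
    ... | false = refl

  lookup-hybrid-cases : ∀ j x y t → lookup (hybrid j x y) t ≡ lookup x t ⊎ lookup (hybrid j x y) t ≡ lookup y t
  lookup-hybrid-cases j x y t rewrite lookup-hybrid j x y t with toℕ t <ᵇ j
  ... | true  = inj₂ refl
  ... | false = inj₁ refl

  hybrid-step-outside : ∀ j x y t → toℕ t ≢ j → lookup (hybrid j x y) t ≡ lookup (hybrid (suc j) x y) t
  hybrid-step-outside j x y t t≢j rewrite lookup-hybrid j x y t | lookup-hybrid (suc j) x y t
    with <-cmp (toℕ t) j
  ... | tri< t<j _ _ rewrite <ᵇ-true t<j | <ᵇ-true (m<n⇒m<1+n t<j) = refl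
  ... | tri≈ _ t≡j _ = ⊥-elim (t≢j t≡j)
  ... | tri> _ _ j<t rewrite <ᵇ-false (<⇒≤ j<t) | <ᵇ-false j<t = refl

  hybrid-step-at : ∀ j x y t → toℕ t ≡ j →
                   lookup (hybrid j x y) t ≡ lookup x t × lookup (hybrid (suc j) x y) t ≡ lookup y t
  hybrid-step-at j x y t refl rewrite lookup-hybrid j x y t | lookup-hybrid (suc j) x y t
    | <ᵇ-false (≤-refl {toℕ t}) | <ᵇ-true (≤-refl {suc (toℕ t)}) = refl , refl

  hybrid-step-trivial : ∀ j x y → (∀ t → toℕ t ≡ j → lookup x t ≡ lookup y t) → hybrid j x y ≡ hybrid (suc j) x y
  hybrid-step-trivial j x y agree = vec-ext _ _ λ t → coordinate t (toℕ t ≟ j)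
    where
    coordinate : ∀ t → Dec (toℕ t ≡ j) → lookup (hybrid j x y) t ≡ lookup (hybrid (suc j) x y) t
    coordinate t (yes t≡j) = let (atJ , atSucJ) = hybrid-step-at j x y t t≡j in
      trans atJ (trans (agree t t≡j) (sym atSucJ))
    coordinate t (no t≢j) = hybrid-step-outside j x y t t≢j

  hybrid-pair-injective : ∀ j {u v u′ v′} → hybrid j u v ≡ hybrid j u′ v′ → hybrid j v u ≡ hybrid j v′ u′ → u ≡ u′
  hybrid-pair-injective j {u} {v} {u′} {v′} e e′ = begin
    u                                        ≡⟨ hybrid-recover j u v ⟨
    hybrid j (hybrid j u v) (hybrid j v u)     ≡⟨ cong₂ (hybrid j) e e′ ⟩
    hybrid j (hybrid j u′ v′) (hybrid j v′ u′) ≡⟨ hybrid-recover j u′ v′ ⟩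
    u′                                       ∎
    where open ≡-Reasoning

crossing : (ℕ → Bool) → ℕ → ℕ
crossing s zero    = 0
crossing s (suc m) = if s m then m else crossing s m

crossing-spec : ∀ s m → s 0 ≡ true → s m ≡ false →
                crossing s m < m × s (crossing s m) ≡ true × s (suc (crossing s m)) ≡ false
crossing-spec s zero    s0 sm = ⊥-elim (true≢false (trans (sym s0) sm))
crossing-spec s (suc m) s0 sm with s m in sm′
... | true  = ≤-refl , sm′ , sm
... | false = let (c<m , before , after) = crossing-spec s m s0 sm′ in m<n⇒m<1+n c<m , before , after

count-tabulate : ∀ {A : Set} n (f : Fin n → A) (p : A → Bool) →
                 count p (List.tabulate f) ≡ count (λ t → p (f t)) (allFin n)
count-tabulate zero    f p = refl
count-tabulate (suc n) f p = begin
  count p (List.tabulate f)                                           ≡⟨ count-∷ p (f Fin.zero) _ ⟩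
  𝟙 (p (f Fin.zero)) + count p (List.tabulate (λ t → f (Fin.suc t)))  ≡⟨ cong (𝟙 (p (f Fin.zero)) +_) (count-tabulate n _ p) ⟩
  𝟙 (p (f Fin.zero)) + count (λ t → p (f (Fin.suc t))) (allFin n)     ≡⟨ cong (𝟙 (p (f Fin.zero)) +_) (count-tabulate n Fin.suc _) ⟨
  𝟙 (p (f Fin.zero)) + count (λ t → p (f t)) (List.tabulate Fin.suc)  ≡⟨ count-∷ (λ t → p (f t)) Fin.zero _ ⟨
  count (λ t → p (f t)) (allFin (suc n))                              ∎
  where open ≡-Reasoning

count-index : ∀ n j → j < n → count (λ t → does (toℕ t ≟ j)) (allFin n) ≡ 1
count-index (suc n) zero    _         =
  cong suc (trans (count-tabulate n Fin.suc (λ t → does (toℕ t ≟ 0))) (count-false (allFin n)))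
count-index (suc n) (suc j) (s≤s j<n) =
  trans (count-tabulate n Fin.suc (λ t → does (toℕ t ≟ suc j))) (count-index n j j<n)

-- Consecutive hybrids of two profiles that differ at coordinate j differ in exactly one
-- coordinate: this is what puts the exit point of a hybrid path on the boundary.
hybrid-step-adjacent : ∀ {n k} j (x y : Profile n k) → j < n → (∀ t → toℕ t ≡ j → lookup x t ≢ lookup y t) →
                       differInExactlyOne (hybrid j x y) (hybrid (suc j) x y) ≡ true
hybrid-step-adjacent {n} j x y j<n differ =
  cong (_≡ᵇ 1) (trans (count-cong _ _ (allFin n) changedAt) (count-index n j j<n))
  where
  changedAt : ∀ t → t ∈ allFin n →
    not (lookup (hybrid j x y) t ==ʳ lookup (hybrid (suc j) x y) t) ≡ does (toℕ t ≟ j)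
  changedAt t _ = byCases (toℕ t ≟ j)
    where
    byCases : Dec (toℕ t ≡ j) →
      not (lookup (hybrid j x y) t ==ʳ lookup (hybrid (suc j) x y) t) ≡ does (toℕ t ≟ j)
    byCases (yes t≡j) = let (atJ , atSucJ) = hybrid-step-at j x y t t≡j in
      trans (cong not (trans (cong₂ _==ʳ_ atJ atSucJ) (dec-false (≡-dec _≟ᶠ_ _ _) (differ t t≡j))))
            (sym (dec-true (toℕ t ≟ j) t≡j))
    byCases (no t≢j) =
      trans (cong not (trans (cong (_==ʳ lookup (hybrid (suc j) x y) t) (hybrid-step-outside j x y t t≢j))
                             (dec-true (≡-dec _≟ᶠ_ next next) refl)))
            (sym (dec-false (toℕ t ≟ j) t≢j))
      where next = lookup (hybrid (suc j) x y) t

length-cartesianProduct : {A B : Set} (xs : List A) (ys : List B) →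
                          length (cartesianProduct xs ys) ≡ length xs * length ys
length-cartesianProduct []       ys = refl
length-cartesianProduct (x ∷ xs) ys =
  trans (length-++ (map (x ,_) ys)) (cong₂ _+_ (length-map _ ys) (length-cartesianProduct xs ys))

-- The
-- map (x , y) ↦ (hybrid at the exit step, exit step, complementary hybrid) injects
-- B × (F \ B) into ∂B × [n] × F, giving  |B| |F \ B| ≤ |∂B| n |F|.
module Isoperimetry {n k : ℕ} (L : List (Profile n k)) (L-unique : Unique L)
  (inF inB : Profile n k → Bool) (B⊆F : ∀ σ → inB σ ≡ true → inF σ ≡ true)
  (F-hybrid-closed : ∀ j x y → x ∈ L → y ∈ L → inF x ≡ true → inF y ≡ true →
                     hybrid j x y ∈ L × inF (hybrid j x y) ≡ true) where

  onBoundary : Profile n k → Bool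
  onBoundary σ = inB σ ∧ any (λ π → inF π ∧ not (inB π) ∧ differInExactlyOne σ π) L

  outside : Profile n k → Bool
  outside σ = inF σ ∧ not (inB σ)

  listOf : (Profile n k → Bool) → List (Profile n k)
  listOf p = filter (λ σ → p σ ≟ᵇ true) L

  pairs : List (Profile n k × Profile n k)
  pairs = cartesianProduct (listOf inB) (listOf outside)

  targets : List (Profile n k × ℕ × Profile n k)
  targets = cartesianProduct (listOf onBoundary) (cartesianProduct (upTo n) (listOf inF))

  exitStep : Profile n k → Profile n k → ℕ
  exitStep x y = crossing (λ i → inB (hybrid i x y)) n

  encode : Profile n k × Profile n k → Profile n k × ℕ × Profile n k
  encode (x , y) = hybrid (exitStep x y) x y , exitStep x y , hybrid (exitStep x y) y x

  encode-injective : ∀ {p q} → encode p ≡ encode q → p ≡ q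
  encode-injective {x , y} {x′ , y′} eq
    with h≡ , rest ← Productₚ.,-injective eq
    with j≡ , h′≡ ← Productₚ.,-injective rest =
    cong₂ _,_ (hybrid-pair-injective (exitStep x y) {x} {y} {x′} {y′} h≡′ h′≡′)
              (hybrid-pair-injective (exitStep x y) {y} {x} {y′} {x′} h′≡′ h≡′)
    where
    h≡′  = subst (λ i → hybrid (exitStep x y) x y ≡ hybrid i x′ y′) (sym j≡) h≡
    h′≡′ = subst (λ i → hybrid (exitStep x y) y x ≡ hybrid i y′ x′) (sym j≡) h′≡

  exit-on-boundary : ∀ x y → x ∈ L → y ∈ L → inB x ≡ true → outside y ≡ true →
                     exitStep x y < n × onBoundary (hybrid (exitStep x y) x y) ≡ true
  exit-on-boundary x y x∈L y∈L Bx Oy = j<n , ∧-intro Bhere (any-witness _ L next∈L nextOutside)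
    where
    j = exitStep x y
    Fx = B⊆F x Bx
    Fy = ∧-conicalˡ (inF y) _ Oy
    ¬By = not-injective (∧-conicalʳ (inF y) _ Oy)
    spec = crossing-spec (λ i → inB (hybrid i x y)) n
             (trans (cong inB (hybrid-zero x y)) Bx) (trans (cong inB (hybrid-full x y)) ¬By)
    j<n = proj₁ spec
    Bhere = proj₁ (proj₂ spec)
    ¬Bnext = proj₂ (proj₂ spec)
    next = F-hybrid-closed (suc j) x y x∈L y∈L Fx Fy
    next∈L = proj₁ next
    -- if x and y agreed at coordinate j, the path would not move at step j
    differ : ∀ t → toℕ t ≡ j → lookup x t ≢ lookup y t
    differ t t≡j x≡y =
      true≢false (trans (sym Bhere) (trans (cong inB (hybrid-step-trivial j x y agree)) ¬Bnext))
      where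
      agree : ∀ t′ → toℕ t′ ≡ j → lookup x t′ ≡ lookup y t′
      agree t′ t′≡j = subst (λ s → lookup x s ≡ lookup y s) (toℕ-injective (trans t≡j (sym t′≡j))) x≡y
    nextOutside = ∧-intro (proj₂ next) (∧-intro (cong not ¬Bnext) (hybrid-step-adjacent j x y j<n differ))

  encode-into : ∀ {t} → t ∈ map encode pairs → t ∈ targets
  encode-into t∈ with (x , y) , p∈ , refl ← ∈-map⁻ encode t∈
    with x∈ , y∈ ← ∈-cartesianProduct⁻ _ _ p∈
    with x∈L , Bx ← ∈-filter⁻ (λ σ → inB σ ≟ᵇ true) x∈
    with y∈L , Oy ← ∈-filter⁻ (λ σ → outside σ ≟ᵇ true) y∈ =
    ∈-cartesianProduct⁺ (∈-filter⁺ _ (proj₁ (F-hybrid-closed j x y x∈L y∈L Fx Fy)) boundary)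
      (∈-cartesianProduct⁺ (∈-upTo⁺ j<n) (∈-filter⁺ _ (proj₁ mirror) (proj₂ mirror)))
    where
    j = exitStep x y
    Fx = B⊆F x Bx
    Fy = ∧-conicalˡ (inF y) _ Oy
    j<n = proj₁ (exit-on-boundary x y x∈L y∈L Bx Oy)
    boundary = proj₂ (exit-on-boundary x y x∈L y∈L Bx Oy)
    mirror = F-hybrid-closed j y x y∈L x∈L Fy Fx

  isoperimetric : count inB L * count outside L ≤ count onBoundary L * (n * count inF L)
  isoperimetric = begin
    count inB L * count outside L             ≡⟨ length-cartesianProduct (listOf inB) (listOf outside) ⟨
    length pairs                              ≡⟨ length-map encode pairs ⟨
    length (map encode pairs)                 ≤⟨ unique-length-≤ decEq (map encode pairs) targets encode-unique encode-into ⟩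
    length targets                            ≡⟨ length-cartesianProduct (listOf onBoundary) _ ⟩
    count onBoundary L * length (cartesianProduct (upTo n) (listOf inF))
                                              ≡⟨ cong (count onBoundary L *_) (length-cartesianProduct (upTo n) (listOf inF)) ⟩
    count onBoundary L * (length (upTo n) * count inF L)
                                              ≡⟨ cong (λ m → count onBoundary L * (m * count inF L)) (length-upTo n) ⟩
    count onBoundary L * (n * count inF L)    ∎
    where
    open ≤-Reasoning
    decEq : DecidableEquality (Profile n k × ℕ × Profile n k)
    decEq = Productₚ.≡-dec (≡-dec (≡-dec _≟ᶠ_)) (Productₚ.≡-dec _≟_ (≡-dec (≡-dec _≟ᶠ_)))
    encode-unique : Unique (map encode pairs)
    encode-unique = Uniqueₚ.map⁺ encode-injective
      (Uniqueₚ.cartesianProduct⁺ (Uniqueₚ.filter⁺ _ L-unique) (Uniqueₚ.filter⁺ _ L-unique))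

-- ℚ as a ring for the reflective ring solver (with a zero test, so that cancelling
-- monomials disappear from normal forms).
ℚring : AlmostCommutativeRing 0ℓ 0ℓ
ℚring = fromCommutativeRing ℚP.+-*-commutativeRing (λ x → dec⇒maybe (0ℚ ℚP.≟ x))

-- The embedding ℕ → ℚ.  Probabilities in Defs are fractions frac a m = a / m, and
-- all estimates are transported from ℕ to ℚ through toℚ, a semiring homomorphism.
toℚ : ℕ → ℚ
toℚ m = frac m 1

toℚᵘ-toℚ : ∀ m → toℚᵘ (toℚ m) ≃ᵘ mkℚᵘ (ℤ⁺ m) 0
toℚᵘ-toℚ m = ℚP.toℚᵘ-fromℚᵘ (mkℚᵘ (ℤ⁺ m) 0)

toℚ-+ : ∀ a b → toℚ (a + b) ≡ toℚ a +ℚ toℚ b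
toℚ-+ a b = ℚP.toℚᵘ-injective (ℚᵘP.≃-trans (toℚᵘ-toℚ (a + b)) (ℚᵘP.≃-trans (*≡* numerators)
  (ℚᵘP.≃-sym (ℚᵘP.≃-trans (ℚP.toℚᵘ-homo-+ (toℚ a) (toℚ b)) (ℚᵘP.+-cong (toℚᵘ-toℚ a) (toℚᵘ-toℚ b))))))
  where
  numerators : (ℤ⁺ (a + b)) ℤ.* (ℤ⁺ 1) ≡ ((ℤ⁺ a) ℤ.* (ℤ⁺ 1) ℤ.+ (ℤ⁺ b) ℤ.* (ℤ⁺ 1)) ℤ.* (ℤ⁺ 1)
  numerators = begin
    (ℤ⁺ (a + b)) ℤ.* (ℤ⁺ 1)                                ≡⟨ ℤP.*-identityʳ _ ⟩
    ℤ⁺ (a + b)                                             ≡⟨ ℤP.pos-+ a b ⟩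
    (ℤ⁺ a) ℤ.+ (ℤ⁺ b)                                      ≡⟨ cong₂ ℤ._+_ (ℤP.*-identityʳ (ℤ⁺ a)) (ℤP.*-identityʳ (ℤ⁺ b)) ⟨
    (ℤ⁺ a) ℤ.* (ℤ⁺ 1) ℤ.+ (ℤ⁺ b) ℤ.* (ℤ⁺ 1)                ≡⟨ ℤP.*-identityʳ _ ⟨
    ((ℤ⁺ a) ℤ.* (ℤ⁺ 1) ℤ.+ (ℤ⁺ b) ℤ.* (ℤ⁺ 1)) ℤ.* (ℤ⁺ 1)  ∎
    where open ≡-Reasoning

toℚ-* : ∀ a b → toℚ (a * b) ≡ toℚ a *ℚ toℚ b
toℚ-* a b = ℚP.toℚᵘ-injective (ℚᵘP.≃-trans (toℚᵘ-toℚ (a * b)) (ℚᵘP.≃-trans (*≡* numerators)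
  (ℚᵘP.≃-sym (ℚᵘP.≃-trans (ℚP.toℚᵘ-homo-* (toℚ a) (toℚ b)) (ℚᵘP.*-cong (toℚᵘ-toℚ a) (toℚᵘ-toℚ b))))))
  where
  numerators : (ℤ⁺ (a * b)) ℤ.* (ℤ⁺ 1) ≡ ((ℤ⁺ a) ℤ.* (ℤ⁺ b)) ℤ.* (ℤ⁺ 1)
  numerators = cong (ℤ._* (ℤ⁺ 1)) (ℤP.pos-* a b)

toℚ-mono : ∀ {a b} → a ≤ b → toℚ a ≤ℚ toℚ b
toℚ-mono {a} {b} a≤b = ℚP.toℚᵘ-cancel-≤ (ℚᵘP.≤-respˡ-≃ (ℚᵘP.≃-sym (toℚᵘ-toℚ a))
  (ℚᵘP.≤-respʳ-≃ (ℚᵘP.≃-sym (toℚᵘ-toℚ b)) (ℚᵘ.*≤* (ℤP.*-monoʳ-≤-nonNeg (ℤ⁺ 1) (ℤ.+≤+ a≤b)))))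

toℚ-nonNeg : ∀ m → ℚ.NonNegative (toℚ m)
toℚ-nonNeg m = ℚ.nonNegative (toℚ-mono {0} {m} z≤n)

toℚ-pos : ∀ m .{{_ : NonZero m}} → ℚ.Positive (toℚ m)
toℚ-pos (suc m) = ℚ.positive (ℚP.toℚᵘ-cancel-<
  (ℚᵘP.<-respʳ-≃ (ℚᵘP.≃-sym (toℚᵘ-toℚ (suc m))) (ℚᵘ.*<* (ℤ.+<+ (s≤s z≤n)))))

frac-cancel : ∀ a m .{{_ : NonZero m}} → frac a m *ℚ toℚ m ≡ toℚ a
frac-cancel a (suc d) = ℚP.toℚᵘ-injective (ℚᵘP.≃-trans (ℚP.toℚᵘ-homo-* (frac a (suc d)) (toℚ (suc d)))
  (ℚᵘP.≃-trans (ℚᵘP.*-cong (ℚP.toℚᵘ-fromℚᵘ (mkℚᵘ (ℤ⁺ a) d)) (toℚᵘ-toℚ (suc d)))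
  (ℚᵘP.≃-trans (*≡* numerators) (ℚᵘP.≃-sym (toℚᵘ-toℚ a)))))
  where
  numerators : (ℤ⁺ a) ℤ.* (ℤ⁺ (suc d)) ℤ.* (ℤ⁺ 1) ≡ (ℤ⁺ a) ℤ.* (ℤ⁺ (suc (d * 1)))
  numerators = trans (ℤP.*-identityʳ _) (cong (λ m → (ℤ⁺ a) ℤ.* (ℤ⁺ (suc m))) (sym (*-identityʳ d)))

frac-inverse : ∀ m .{{_ : NonZero m}} → frac 1 m *ℚ toℚ m ≡ 1ℚ
frac-inverse m = frac-cancel 1 m

-- a / m = a · (1 / m), also in the degenerate case m = 0 where both sides are 0
frac-as-product : ∀ a m → frac a m ≡ toℚ a *ℚ frac 1 m
frac-as-product a zero    = sym (ℚP.*-zeroʳ (toℚ a))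
frac-as-product a m@(suc _) = begin
  frac a m                                  ≡⟨ ℚP.*-identityʳ (frac a m) ⟨
  frac a m *ℚ 1ℚ                            ≡⟨ cong (frac a m *ℚ_) (frac-inverse m) ⟨
  frac a m *ℚ (frac 1 m *ℚ toℚ m)           ≡⟨ swap₂₃ (frac a m) (frac 1 m) (toℚ m) ⟩
  frac a m *ℚ toℚ m *ℚ frac 1 m             ≡⟨ cong (_*ℚ frac 1 m) (frac-cancel a m) ⟩
  toℚ a *ℚ frac 1 m                         ∎
  where
  open ≡-Reasoning
  swap₂₃ : ∀ x y z → x *ℚ (y *ℚ z) ≡ x *ℚ z *ℚ y
  swap₂₃ = ring-∀ ℚring

frac-nonNeg : ∀ a m → 0ℚ ≤ℚ frac a m
frac-nonNeg a zero    = ℚP.≤-refl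
frac-nonNeg a (suc d) = ℚP.toℚᵘ-cancel-≤ (ℚᵘP.≤-respʳ-≃ (ℚᵘP.≃-sym (ℚP.toℚᵘ-fromℚᵘ (mkℚᵘ (ℤ⁺ a) d)))
  (ℚᵘ.*≤* (subst (ℤ⁺ 0 ℤ.≤_) (sym (ℤP.*-identityʳ (ℤ⁺ a))) (ℤ.+≤+ z≤n))))

scaled-zero-≤ : ∀ δ m → δ *ℚ toℚ 0 ≤ℚ toℚ m
scaled-zero-≤ δ m = subst (_≤ℚ toℚ m) (sym (ℚP.*-zeroʳ δ)) (ℚP.nonNegative⁻¹ _ {{toℚ-nonNeg m}})

Prob-nonNeg : ∀ {n k} (p : Profile n k → Bool) → 0ℚ ≤ℚ Prob p
Prob-nonNeg {n} {k} p = frac-nonNeg (count p (Skn n k)) (length (Skn n k))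

-- Two ring identities for rearranging  b ≤ (1 - δ)(b + c)  into  δ (b + c) ≤ c.
cancel-summand : ∀ δ B C → B +ℚ (δ *ℚ (B +ℚ C) - B) ≡ δ *ℚ (B +ℚ C)
cancel-summand = ring-∀ ℚring

complement-identity : ∀ δ B C → (1ℚ - δ) *ℚ (B +ℚ C) +ℚ (δ *ℚ (B +ℚ C) - B) ≡ C
complement-identity = ring-∀ ℚring

small-complement : ∀ (δ : ℚ) b c → frac b (b + c) <ℚ 1ℚ - δ → δ *ℚ toℚ (b + c) ≤ℚ toℚ c
small-complement δ b c small with b + c in m≡
... | zero      = scaled-zero-≤ δ c
... | m@(suc _) = subst (λ x → δ *ℚ x ≤ℚ toℚ c) (trans (sym (toℚ-+ b c)) (cong toℚ m≡)) complement
  where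
  B = toℚ b
  C = toℚ c
  -- b = (b/m)·m ≤ (1 - δ)·m
  b≤ : B ≤ℚ (1ℚ - δ) *ℚ (B +ℚ C)
  b≤ = subst₂ _≤ℚ_ (frac-cancel b m) (cong ((1ℚ - δ) *ℚ_) (trans (cong toℚ (sym m≡)) (toℚ-+ b c)))
         (ℚP.*-monoʳ-≤-nonNeg (toℚ m) {{toℚ-nonNeg m}} (ℚP.<⇒≤ small))
  complement : δ *ℚ (B +ℚ C) ≤ℚ C
  complement = subst₂ _≤ℚ_ (cancel-summand δ B C) (complement-identity δ B C)
                 (ℚP.+-monoˡ-≤ (δ *ℚ (B +ℚ C) - B) b≤)

swap-last : ∀ x y z → x *ℚ y *ℚ z ≡ x *ℚ z *ℚ y
swap-last = ring-∀ ℚring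

small-set-bound : ∀ (δ : ℚ) (n b c d : ℕ) → b * c ≤ d * (n * (b + c)) → frac b (b + c) <ℚ 1ℚ - δ →
                  δ *ℚ toℚ b ≤ℚ toℚ (n * d)
small-set-bound δ n zero c d _ _ = scaled-zero-≤ δ (n * d)
small-set-bound δ n b@(suc _) c d isoperimetric small =
  ℚP.*-cancelʳ-≤-pos (toℚ m) {{toℚ-pos m}} (begin
    δ *ℚ toℚ b *ℚ toℚ m         ≡⟨ swap-last δ (toℚ b) (toℚ m) ⟩
    δ *ℚ toℚ m *ℚ toℚ b         ≤⟨ ℚP.*-monoʳ-≤-nonNeg (toℚ b) {{toℚ-nonNeg b}} (small-complement δ b c small) ⟩
    toℚ c *ℚ toℚ b              ≡⟨ toℚ-* c b ⟨
    toℚ (c * b)                 ≤⟨ toℚ-mono cb≤ ⟩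
    toℚ (n * d * m)             ≡⟨ toℚ-* (n * d) m ⟩
    toℚ (n * d) *ℚ toℚ m        ∎)
  where
  open ℚP.≤-Reasoning
  m = b + c
  cb≤ : c * b ≤ n * d * m
  cb≤ = subst₂ _≤_ (*-comm b c) (trans (sym (*-assoc d n m)) (cong (_* m) (*-comm d n))) isoperimetric

∑-bound : {Z : Set} (δ : ℚ) (n : ℕ) (s d : Z → ℕ) (zs : List Z) →
          (∀ z → δ *ℚ toℚ (s z) ≤ℚ toℚ (n * d z)) → δ *ℚ toℚ (∑ s zs) ≤ℚ toℚ (n * ∑ d zs)
∑-bound δ n s d []       _     = scaled-zero-≤ δ (n * 0)
∑-bound δ n s d (z ∷ zs) bound = begin
  δ *ℚ toℚ (s z + ∑ s zs)                       ≡⟨ cong (δ *ℚ_) (toℚ-+ (s z) (∑ s zs)) ⟩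
  δ *ℚ (toℚ (s z) +ℚ toℚ (∑ s zs))              ≡⟨ ℚP.*-distribˡ-+ δ (toℚ (s z)) (toℚ (∑ s zs)) ⟩
  δ *ℚ toℚ (s z) +ℚ δ *ℚ toℚ (∑ s zs)           ≤⟨ ℚP.+-mono-≤ (bound z) (∑-bound δ n s d zs bound) ⟩
  toℚ (n * d z) +ℚ toℚ (n * ∑ d zs)             ≡⟨ toℚ-+ (n * d z) (n * ∑ d zs) ⟨
  toℚ (n * d z + n * ∑ d zs)                    ≡⟨ cong toℚ (*-distribˡ-+ n (d z) (∑ d zs)) ⟨
  toℚ (n * (d z + ∑ d zs))                      ∎
  where open ℚP.≤-Reasoning

-- Each fiber F^{a,b}(z) is closed under hybrids,
-- so the isoperimetric inequality applies to B_1^{a,b}(z) ⊆ F^{a,b}(z); small fibers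
-- then satisfy δ |B_1^{a,b}(z)| ≤ n |∂B_1^{a,b}(z)|, and summing over z compares the
-- two probabilities of the corollary.
module FiberEstimate {n k : ℕ} (ε : ℚ) (f : SCF n k) (a b : Fin k) where

  L : List (Profile n k)
  L = Skn n k

  -- the smallness threshold is 1 - δ
  δ : ℚ
  δ = ε *ℚ ε *ℚ ε *ℚ frac 1 (4 * n ^ 3 * k ^ 9)

  fiber-key : ∀ (z : Vec Bool n) (σ : Profile n k) → inF a b z σ ≡ true → z ≡ xab a b σ
  fiber-key z σ σ∈F = sym (from-does (≡-dec _≟ᵇ_ (xab a b σ) z) σ∈F)

  -- x^{a,b} is computed coordinatewise, so a fiber is a product set and contains the
  -- hybrids of its elements
  fiber-hybrid-closed : ∀ z j x y → x ∈ L → y ∈ L → inF a b z x ≡ true → inF a b z y ≡ true →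
                        hybrid j x y ∈ L × inF a b z (hybrid j x y) ≡ true
  fiber-hybrid-closed z j x y x∈L y∈L x∈F y∈F =
    vecsOver-complete (Sk k) n (hybrid j x y) (λ t → fromEither (lookup-hybrid-cases j x y t)) ,
    dec-true (≡-dec _≟ᵇ_ (xab a b (hybrid j x y)) z) (vec-ext _ _ signs)
    where
    above : Ranking k → Bool
    above r = ranksAbove r a b
    fromEither : ∀ {t} → lookup (hybrid j x y) t ≡ lookup x t ⊎ lookup (hybrid j x y) t ≡ lookup y t →
                 lookup (hybrid j x y) t ∈ Sk k
    fromEither {t} (inj₁ e) = subst (_∈ Sk k) (sym e) (vecsOver-sound (Sk k) n x x∈L t)
    fromEither {t} (inj₂ e) = subst (_∈ Sk k) (sym e) (vecsOver-sound (Sk k) n y y∈L t)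
    signOf : ∀ {v} t → inF a b z v ≡ true → above (lookup v t) ≡ lookup z t
    signOf {v} t v∈F = trans (sym (lookup-map t above v)) (cong (λ w → lookup w t) (sym (fiber-key z v v∈F)))
    signs : ∀ t → lookup (xab a b (hybrid j x y)) t ≡ lookup z t
    signs t with lookup-hybrid-cases j x y t
    ... | inj₁ e = trans (lookup-map t above (hybrid j x y)) (trans (cong above e) (signOf {x} t x∈F))
    ... | inj₂ e = trans (lookup-map t above (hybrid j x y)) (trans (cong above e) (signOf {y} t y∈F))

  module Fiber (z : Vec Bool n) =
    Isoperimetry L (Skn-unique n k) (inF a b z) (inB1 f a b z) (λ σ → ∧-conicalˡ (inF a b z σ) _)
                 (fiber-hybrid-closed z)

  fiber-size : ∀ z → count (inF a b z) L ≡ count (inB1 f a b z) L + count (Fiber.outside z) L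
  fiber-size z = trans (count-split (inF a b z) (inB1 f a b z) L)
                       (cong (_+ count (Fiber.outside z) L) (count-cong _ _ L B∧F))
    where
    B∧F : ∀ σ → σ ∈ L → (inF a b z σ ∧ inB1 f a b z σ) ≡ inB1 f a b z σ
    B∧F σ _ with inF a b z σ
    ... | true  = refl
    ... | false = refl

  small-fiber : ∀ z → isSmall ε f a b z ≡ true →
                δ *ℚ toℚ (count (inB1 f a b z) L) ≤ℚ toℚ (n * count (inBoundary f a b z) L)
  small-fiber z small = small-set-bound δ n |B| |F∖B| |∂B|
    (subst (λ m → |B| * |F∖B| ≤ |∂B| * (n * m)) (fiber-size z) (Fiber.isoperimetric z))
    (subst (λ m → frac |B| m <ℚ 1ℚ - δ) (fiber-size z)
           (from-does (frac |B| (count (inF a b z) L) ℚP.<? (1ℚ - δ)) small))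
    where
    |B| = count (inB1 f a b z) L
    |F∖B| = count (Fiber.outside z) L
    |∂B| = count (inBoundary f a b z) L

  -- the part of Sm(B_1^{a,b}) in fiber z is B_1^{a,b}(z) or empty
  fiber-bound : ∀ z → δ *ℚ toℚ (count (λ σ → isSmall ε f a b z ∧ inB1 f a b z σ) L)
                       ≤ℚ toℚ (n * count (inBoundary f a b z) L)
  fiber-bound z = bySmallness (isSmall ε f a b z) refl
    where
    |∂B| = count (inBoundary f a b z) L
    bySmallness : ∀ s → isSmall ε f a b z ≡ s →
                  δ *ℚ toℚ (count (λ σ → s ∧ inB1 f a b z σ) L) ≤ℚ toℚ (n * |∂B|)
    bySmallness true  small = small-fiber z small
    bySmallness false _     =
      subst (λ m → δ *ℚ toℚ m ≤ℚ toℚ (n * |∂B|)) (sym (count-false L)) (scaled-zero-≤ δ (n * |∂B|))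

  small-vs-boundary : δ *ℚ toℚ (count (inSm ε f a b) L) ≤ℚ toℚ (n * count (inUnionBoundary f a b) L)
  small-vs-boundary =
    subst₂ (λ S D → δ *ℚ toℚ S ≤ℚ toℚ (n * D))
      (sym (count-any (λ z σ → isSmall ε f a b z ∧ inB1 f a b z σ) (xab a b) (cube n) (cube-unique n)
             (λ z σ inSmz → fiber-key z σ (∧-conicalˡ _ _ (∧-conicalʳ (isSmall ε f a b z) _ inSmz))) L))
      (sym (count-any (inBoundary f a b) (xab a b) (cube n) (cube-unique n)
             (λ z σ σ∈∂ → fiber-key z σ (∧-conicalˡ _ _ (∧-conicalˡ _ _ σ∈∂))) L))
      (∑-bound δ n _ _ (cube n) fiber-bound)

  small-vs-boundary-prob : δ *ℚ Prob (inSm ε f a b) ≤ℚ toℚ n *ℚ Prob (inUnionBoundary f a b)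
  small-vs-boundary-prob = begin
    δ *ℚ Prob (inSm ε f a b)                  ≡⟨ cong (δ *ℚ_) (frac-as-product S N) ⟩
    δ *ℚ (toℚ S *ℚ frac 1 N)                  ≡⟨ ℚP.*-assoc δ (toℚ S) (frac 1 N) ⟨
    δ *ℚ toℚ S *ℚ frac 1 N                    ≤⟨ ℚP.*-monoʳ-≤-nonNeg (frac 1 N) {{ℚ.nonNegative (frac-nonNeg 1 N)}} small-vs-boundary ⟩
    toℚ (n * D) *ℚ frac 1 N                   ≡⟨ cong (_*ℚ frac 1 N) (toℚ-* n D) ⟩
    toℚ n *ℚ toℚ D *ℚ frac 1 N                ≡⟨ ℚP.*-assoc (toℚ n) (toℚ D) (frac 1 N) ⟩
    toℚ n *ℚ (toℚ D *ℚ frac 1 N)              ≡⟨ cong (toℚ n *ℚ_) (frac-as-product D N) ⟨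
    toℚ n *ℚ Prob (inUnionBoundary f a b)     ∎
    where
    open ℚP.≤-Reasoning
    S = count (inSm ε f a b) L
    D = count (inUnionBoundary f a b) L
    N = length L

regroup-lower : ∀ e s A r B → e *ℚ (s *ℚ A) *ℚ (r *ℚ B) ≡ e *ℚ r *ℚ s *ℚ (B *ℚ A)
regroup-lower = ring-∀ ℚring

regroup-upper : ∀ n d A B → n *ℚ d *ℚ (B *ℚ A) ≡ d *ℚ (n *ℚ A *ℚ B)
regroup-upper = ring-∀ ℚring

drop-unit : ∀ x {y z} → y *ℚ z ≡ 1ℚ → x *ℚ y *ℚ z ≡ x
drop-unit x {y} {z} yz≡1 = trans (ℚP.*-assoc x y z) (trans (cong (x *ℚ_) yz≡1) (ℚP.*-identityʳ x))

chain-estimates : ∀ (ε s d : ℚ) (n A B K : ℕ) .{{_ : NonZero A}} .{{_ : NonZero B}} .{{_ : NonZero K}} →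
  0ℚ ≤ℚ ε → 0ℚ ≤ℚ d → n * A * B ≤ K →
  ε *ℚ frac 1 A ≤ℚ s → ε *ℚ ε *ℚ ε *ℚ frac 1 B *ℚ s ≤ℚ toℚ n *ℚ d →
  ε *ℚ ε *ℚ ε *ℚ ε *ℚ frac 1 K ≤ℚ d
chain-estimates ε s d n A B K 0≤ε 0≤d nAB≤K lower upper =
  ℚP.*-cancelʳ-≤-pos (toℚ K) {{toℚ-pos K}} (begin
    ε³ *ℚ ε *ℚ frac 1 K *ℚ toℚ K                      ≡⟨ drop-unit (ε³ *ℚ ε) (frac-inverse K) ⟩
    ε³ *ℚ ε                                           ≡⟨ cong (ε³ *ℚ_) (drop-unit ε (frac-inverse A)) ⟨
    ε³ *ℚ (ε *ℚ frac 1 A *ℚ toℚ A)                    ≤⟨ ℚP.*-monoˡ-≤-nonNeg ε³ (ℚP.*-monoʳ-≤-nonNeg (toℚ A) {{toℚ-nonNeg A}} lower) ⟩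
    ε³ *ℚ (s *ℚ toℚ A)                                ≡⟨ ℚP.*-identityʳ _ ⟨
    ε³ *ℚ (s *ℚ toℚ A) *ℚ 1ℚ                          ≡⟨ cong (ε³ *ℚ (s *ℚ toℚ A) *ℚ_) (frac-inverse B) ⟨
    ε³ *ℚ (s *ℚ toℚ A) *ℚ (frac 1 B *ℚ toℚ B)         ≡⟨ regroup-lower ε³ s (toℚ A) (frac 1 B) (toℚ B) ⟩
    ε³ *ℚ frac 1 B *ℚ s *ℚ (toℚ B *ℚ toℚ A)           ≤⟨ ℚP.*-monoʳ-≤-nonNeg (toℚ B *ℚ toℚ A) {{BA-nonNeg}} upper ⟩
    toℚ n *ℚ d *ℚ (toℚ B *ℚ toℚ A)                    ≡⟨ regroup-upper (toℚ n) d (toℚ A) (toℚ B) ⟩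
    d *ℚ (toℚ n *ℚ toℚ A *ℚ toℚ B)                    ≡⟨ cong (d *ℚ_) (trans (toℚ-* (n * A) B) (cong (_*ℚ toℚ B) (toℚ-* n A))) ⟨
    d *ℚ toℚ (n * A * B)                              ≤⟨ ℚP.*-monoˡ-≤-nonNeg d (toℚ-mono nAB≤K) ⟩
    d *ℚ toℚ K                                        ∎)
  where
  open ℚP.≤-Reasoning
  ε³ = ε *ℚ ε *ℚ ε
  instance
    ε-nonNeg : ℚ.NonNegative ε
    ε-nonNeg = ℚ.nonNegative 0≤ε
    d-nonNeg : ℚ.NonNegative d
    d-nonNeg = ℚ.nonNegative 0≤d
    ε³-nonNeg : ℚ.NonNegative ε³
    ε³-nonNeg = ℚP.nonNeg*nonNeg⇒nonNeg (ε *ℚ ε) {{ℚP.nonNeg*nonNeg⇒nonNeg ε ε}} ε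
  BA-nonNeg : ℚ.NonNegative (toℚ B *ℚ toℚ A)
  BA-nonNeg = ℚP.nonNeg*nonNeg⇒nonNeg (toℚ B) {{toℚ-nonNeg B}} (toℚ A) {{toℚ-nonNeg A}}

factorial-≥2 : ∀ k → 2 ≤ k → 2 ≤ k !
factorial-≥2 (suc zero)    (s≤s ())
factorial-≥2 (suc (suc j)) _ = *-mono-≤ {2} {suc (suc j)} {1} (s≤s (s≤s z≤n)) (1≤n! (suc j))

degree-bound : ∀ n k → 2 ≤ k → n * (n * k ^ 3) * (4 * n ^ 3 * k ^ 9) ≤ 2 * n ^ 5 * k ^ 12 * k !
degree-bound n k 2≤k = begin
  n * (n * k ^ 3) * (4 * n ^ 3 * k ^ 9)  ≡⟨ collect n k ⟩
  2 * n ^ 5 * k ^ 12 * 2                 ≤⟨ *-monoʳ-≤ (2 * n ^ 5 * k ^ 12) (factorial-≥2 k 2≤k) ⟩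
  2 * n ^ 5 * k ^ 12 * k !               ∎
  where
  open ≤-Reasoning
  open +-*-Solver
  collect : ∀ n k → n * (n * k ^ 3) * (4 * n ^ 3 * k ^ 9) ≡ 2 * n ^ 5 * k ^ 12 * 2
  collect = solve 2 (λ n k → n :* (n :* k :^ 3) :* (con 4 :* n :^ 3 :* k :^ 9)
                             := con 2 :* n :^ 5 :* k :^ 12 :* con 2) refl

-- Corollary 3.6.  Only the mass assumption on Sm(B_1^{a,b}) enters: the fiber estimate
-- gives δ P(Sm) ≤ n P(∂) with δ = ε³/(4n³k⁹), which is chained with P(Sm) ≥ ε/(nk³).
corollary3p6 : (n k : ℕ) → 2 ≤ n → 3 ≤ k → (ε : ℚ) → 0ℚ <ℚ ε →
    (f : SCF n k) → DistNonManipAtLeast f ε →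
    (a b : Fin k) → a ≢ b →
    ε *ℚ frac 1 (n * k ^ 3) ≤ℚ Prob (inSm ε f a b) →
    ε *ℚ ε *ℚ ε *ℚ ε *ℚ frac 1 (2 * n ^ 5 * k ^ 12 * k !) ≤ℚ Prob (inUnionBoundary f a b)
corollary3p6 n k 2≤n 3≤k ε 0<ε f _ a b _ smallMass =
  chain-estimates ε (Prob (inSm ε f a b)) (Prob (inUnionBoundary f a b))
    n (n * k ^ 3) (4 * n ^ 3 * k ^ 9) (2 * n ^ 5 * k ^ 12 * k !) {{A≢0}} {{B≢0}} {{K≢0}}
    (ℚP.<⇒≤ 0<ε) (Prob-nonNeg (inUnionBoundary f a b)) (degree-bound n k 2≤k)
    smallMass (FiberEstimate.small-vs-boundary-prob ε f a b)
  where
  2≤k = ≤-trans (n≤1+n 2) 3≤k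
  instance
    n≢0 : NonZero n
    n≢0 = >-nonZero (≤-trans (n≤1+n 1) 2≤n)
    k≢0 : NonZero k
    k≢0 = >-nonZero (≤-trans (n≤1+n 1) 2≤k)
  A≢0 : NonZero (n * k ^ 3)
  A≢0 = m*n≢0 n (k ^ 3) {{n≢0}} {{m^n≢0 k 3}}
  B≢0 : NonZero (4 * n ^ 3 * k ^ 9)
  B≢0 = m*n≢0 (4 * n ^ 3) (k ^ 9) {{m*n≢0 4 (n ^ 3) {{_}} {{m^n≢0 n 3}}}} {{m^n≢0 k 9}}
  K≢0 : NonZero (2 * n ^ 5 * k ^ 12 * k !)
  K≢0 = m*n≢0 (2 * n ^ 5 * k ^ 12) (k !)
          {{m*n≢0 (2 * n ^ 5) (k ^ 12) {{m*n≢0 2 (n ^ 5) {{_}} {{m^n≢0 n 5}}}} {{m^n≢0 k 12}}}} {{k !≢0}}
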